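{- Let $b\ge2$ and $N$ be positive integers with $\gcd(N,b)=1$ and $\mathcal{M}_b(N)\neq\varnothing$, and let $q$ be a prime divisor of $|b|_N$. Then there exists a positive integer $z$ with $\gcd(z,b)=1$ such that: (1) $|b|_{zN}=|b|_N$; (2) $\mathcal{M}_b(zN)\neq\varnothing$; (3) every $d\in\mathcal{M}_b(zN)$ satisfies $\nu_q(d)=\nu_q(|b|_N)$.
   Context: $\nu_q(x)$ is the exponent of the prime $q$ in the prime factorization of $x$. $|b|_N$ denotes the multiplicative order of $b$ modulo $N$ (defined only when $\gcd(N,b)=1$), and $\mathbb{U}_N=\{x: 1\le x<N,\ \gcd(x,N)=1\}$. Midy's set: for an integer $d\ge 2$ dividing $|b|_N$, put $L=|b|_N$ and $k=L/d$. For $x\in\mathbb{U}_N$, let $a_1\cdots a_L$ be the base-$b$ digits (padded with leading zeros to exactly $L$ digits) of the integer $x(b^L-1)/N$ (the period of the base-$b$ expansion of $x/N$). For $j=1,\dots,d$ let $A_j=[a_{(j-1)k+1}\cdots a_{jk}]_b$ be the integer with the $j$-th block of $k$ digits, and $S_d(x)=\sum_{j=1}^d A_j$. $N$ has the Midy property for $b$ and $d$ if $b^k-1\mid S_d(x)$ for all $x\in\mathbb{U}_N$; the Midy set $\mathcal{M}_b(N)$ is the set of integers $d\ge2$ dividing $|b|_N$ for which this holds. -}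

module Defs where

open import Data.Nat using (ℕ; zero; suc; _+_; _*_; _∸_; _^_; _≤_; _<_)
open import Data.Nat.DivMod using (_/_; _%_)
open import Data.Nat.Divisibility using (_∣_)
open import Data.Nat.Coprimality using (Coprime)
open import Data.List using (map; upTo)
open import Data.Nat.ListAction using (sum)
open import Data.Product using (_×_)
open import Relation.Nullary using (¬_)

-- floor division / remainder with a total convention for divisor 0
-- (only ever used with nonzero divisors below)
_div'_ : ℕ → ℕ → ℕ
m div' zero    = 0
m div' (suc n) = m / suc n

_mod'_ : ℕ → ℕ → ℕ
m mod' zero    = m
m mod' (suc n) = m % suc n

IsOrder : ℕ → ℕ → ℕ → Set
IsOrder b N L = (1 ≤ L) × (N ∣ (b ^ L ∸ 1)) × (∀ m → 1 ≤ m → N ∣ (b ^ m ∸ 1) → L ≤ m)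

-- the integer whose L base-b digits are the period of x/N
period : ℕ → ℕ → ℕ → ℕ → ℕ
period b N L x = (x * (b ^ L ∸ 1)) div' N

-- A_j for j = 1..d, with k = L/d: the j-th block of k digits (from the left)
block : ℕ → ℕ → ℕ → ℕ → ℕ → ℕ → ℕ
block b N L d x j = (period b N L x div' (b ^ ((d ∸ j) * (L div' d)))) mod' (b ^ (L div' d))

S : ℕ → ℕ → ℕ → ℕ → ℕ → ℕ
S b N L d x = sum (map (λ i → block b N L d x (suc i)) (upTo d))

InMidy : ℕ → ℕ → ℕ → ℕ → Set
InMidy b N L d =
  (2 ≤ d) × (d ∣ L) ×
  (∀ x → 1 ≤ x → x < N → Coprime x N → (b ^ (L div' d) ∸ 1) ∣ S b N L d x)

Val : ℕ → ℕ → ℕ → Set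
Val q x e = (q ^ e ∣ x) × ¬ (q ^ suc e ∣ x)

module Submission where

-- Write P = period b N L x for the L-digit period of x/N and
-- k = L/d.  Cutting P into its d blocks of k base-b digits and using
-- b^k ≡ 1 (mod b^k - 1) gives P ≡ S_d(x) (mod b^k - 1), so d ∈ M_b(N)
-- holds iff b^k - 1 divides every period, and in particular forces
-- b^k - 1 ∣ period(1) = (b^L - 1)/N.
--
-- Let R_n = (b^n - 1)/(b - 1) be the base-b repunit.  If d₀ ∈ M_b(N) with
-- k₀ = L/d₀, write period(1) = u (b^k₀ - 1); then z = u R_k₀ satisfies
-- z N = R_L.  For the modulus R_L everything is explicit: its periods are
-- x (b - 1), so L ∈ M_b(R_L) (digit sums of multiples of b - 1), while any
-- d ∈ M_b(R_L) needs b^(L/d) - 1 ∣ b - 1, i.e. L/d = 1.  Hence M_b(zN) = {L},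
-- and the claim on ν_q is immediate.  Since N ∣ R_L ∣ b^L - 1 the order
-- stays L, and R_L ≡ 1 (mod b) makes z coprime to b.

open import Defs
open import Data.Nat using (ℕ; zero; suc; _+_; _*_; _∸_; _^_; _≤_; _<_; z≤n; s≤s; >-nonZero; >-nonZero⁻¹)
open import Data.Nat.Properties
open import Data.Nat.DivMod using (m≡m%n+[m/n]*n; m/n/o≡m/[n*o]; n/1≡n; m<n⇒m/n≡0; m/n*n≡m; m*n/n≡m; n/n≡1; /-monoˡ-≤)
open import Data.Nat.Divisibility using (_∣_; divides; ∣-trans; ∣m+n∣m⇒∣n; ∣m∣n⇒∣m+n; m∣m*n; n∣m*n; ∣-refl; ∣1⇒≡1; *-cancelˡ-∣; ∣⇒≤)
open import Data.Nat.Coprimality using (Coprime)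
open import Data.Nat.Primality using (Prime)
open import Data.Nat.ListAction using (sum)
open import Data.Nat.ListAction.Properties using (sum-++)
open import Data.List using (map; upTo; _++_; [_])
open import Data.List.Properties using (applyUpTo-∷ʳ; map-++)
open import Data.Product using (Σ; _×_; _,_; proj₁; proj₂)
open import Relation.Binary.PropositionalEquality hiding ([_])
open import Data.Nat.Solver using (module +-*-Solver)
open +-*-Solver using (solve; _:=_; _:+_; _:*_; con)

div'-mod' : ∀ x y → 1 ≤ y → x ≡ x mod' y + x div' y * y
div'-mod' x (suc y) _ = m≡m%n+[m/n]*n x (suc y)

div'-div' : ∀ x y z → 1 ≤ y → 1 ≤ z → (x div' y) div' z ≡ x div' (y * z)
div'-div' x (suc y) (suc z) _ _ = m/n/o≡m/[n*o] x (suc y) (suc z)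

div'-small : ∀ x y → x < y → x div' y ≡ 0
div'-small x (suc y) x<y = m<n⇒m/n≡0 x<y

div'-exact : ∀ x y → 1 ≤ y → y ∣ x → x div' y * y ≡ x
div'-exact x (suc y) _ y∣x = m/n*n≡m y∣x

mul-div' : ∀ m y → 1 ≤ y → (m * y) div' y ≡ m
mul-div' m (suc y) _ = m*n/n≡m m (suc y)

pow-pos : ∀ b n → 1 ≤ b → 1 ≤ b ^ n
pow-pos (suc b) n _ = m^n>0 (suc b) n

period-< : ∀ b N L x → 1 ≤ b → x ≤ N → period b N L x < b ^ L
period-< b zero L x 1≤b _ = pow-pos b L 1≤b
period-< b (suc n) L x 1≤b x≤N = begin-strict
    (x * e) div' suc n        ≤⟨ /-monoˡ-≤ (suc n) (*-monoˡ-≤ e x≤N) ⟩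
    (suc n * e) div' suc n    ≡⟨ cong (_div' suc n) (*-comm (suc n) e) ⟩
    (e * suc n) div' suc n    ≡⟨ mul-div' e (suc n) (s≤s z≤n) ⟩
    b ^ L ∸ 1                 <⟨ ∸-monoʳ-< {o = 0} (s≤s z≤n) (pow-pos b L 1≤b) ⟩
    b ^ L                     ∎
  where
  open ≤-Reasoning
  e : ℕ
  e = b ^ L ∸ 1

dropBlocks : ℕ → ℕ → ℕ → ℕ → ℕ
dropBlocks b k P t = P div' (b ^ (t * k))

blockAt : ℕ → ℕ → ℕ → ℕ → ℕ
blockAt b k P t = dropBlocks b k P t mod' (b ^ k)

-- Peeling off one block: Y = r + b^k Y' = Y' + r + (b^k - 1) Y'.
dropBlocks-step : ∀ b k P t → 1 ≤ b →
  dropBlocks b k P t ≡ dropBlocks b k P (suc t) + blockAt b k P t + (b ^ k ∸ 1) * dropBlocks b k P (suc t)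
dropBlocks-step b k P t 1≤b = begin
    Y                         ≡⟨ div'-mod' Y B 1≤B ⟩
    r + Y div' B * B          ≡⟨ cong (λ w → r + w * B) Y/B≡Y′ ⟩
    r + Y′ * B                ≡⟨ cong (λ w → r + Y′ * w) (sym (m∸n+n≡m 1≤B)) ⟩
    r + Y′ * (B ∸ 1 + 1)      ≡⟨ solve 3 (λ r y e → r :+ y :* (e :+ con 1) := y :+ r :+ e :* y) refl r Y′ (B ∸ 1) ⟩
    Y′ + r + (B ∸ 1) * Y′     ∎
  where
  open ≡-Reasoning
  B : ℕ
  B = b ^ k
  Y : ℕ
  Y = dropBlocks b k P t
  Y′ : ℕ
  Y′ = dropBlocks b k P (suc t)
  r : ℕ
  r = blockAt b k P t
  1≤B : 1 ≤ B
  1≤B = pow-pos b k 1≤b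
  Y/B≡Y′ : Y div' B ≡ Y′
  Y/B≡Y′ = trans (div'-div' P (b ^ (t * k)) B (pow-pos b (t * k) 1≤b) 1≤B)
             (cong (P div'_) (trans (*-comm (b ^ (t * k)) B) (sym (^-distribˡ-+-* b k (t * k)))))

sum-upTo-suc : ∀ (g : ℕ → ℕ) n → sum (map g (upTo (suc n))) ≡ sum (map g (upTo n)) + g n
sum-upTo-suc g n = begin
    sum (map g (upTo (suc n)))          ≡⟨ cong (λ l → sum (map g l)) (sym (applyUpTo-∷ʳ (λ i → i) n)) ⟩
    sum (map g (upTo n ++ [ n ]))       ≡⟨ cong sum (map-++ g (upTo n) [ n ]) ⟩
    sum (map g (upTo n) ++ [ g n ])     ≡⟨ sum-++ (map g (upTo n)) [ g n ] ⟩
    sum (map g (upTo n)) + (g n + 0)    ≡⟨ cong (sum (map g (upTo n)) +_) (+-identityʳ (g n)) ⟩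
    sum (map g (upTo n)) + g n          ∎
  where open ≡-Reasoning

dropBlocks-sum : ∀ b k P → 1 ≤ b → ∀ n m d → n + m ≡ d →
  Σ ℕ (λ C → dropBlocks b k P m ≡
    dropBlocks b k P d + sum (map (λ i → blockAt b k P (d ∸ suc i)) (upTo n)) + (b ^ k ∸ 1) * C)
dropBlocks-sum b k P 1≤b zero m .m refl =
  0 , solve 2 (λ y e → y := y :+ con 0 :+ e :* con 0) refl (dropBlocks b k P m) (b ^ k ∸ 1)
dropBlocks-sum b k P 1≤b (suc n) m .(suc n + m) refl
  with dropBlocks-sum b k P 1≤b n (suc m) (suc n + m) (+-suc n m)
... | C , ih = C + Y′ , (begin
    dropBlocks b k P m               ≡⟨ dropBlocks-step b k P m 1≤b ⟩
    Y′ + r + e * Y′                  ≡⟨ cong (λ w → w + r + e * Y′) ih ⟩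
    top + s + e * C + r + e * Y′     ≡⟨ solve 6 (λ a s c r y e → a :+ s :+ e :* c :+ r :+ e :* y := a :+ (s :+ r) :+ e :* (c :+ y)) refl top s C r Y′ e ⟩
    top + (s + r) + e * (C + Y′)     ≡⟨ cong (λ w → top + w + e * (C + Y′)) (sym blocks-suc) ⟩
    top + sum (map g (upTo (suc n))) + e * (C + Y′) ∎)
  where
  open ≡-Reasoning
  e : ℕ
  e = b ^ k ∸ 1
  Y′ : ℕ
  Y′ = dropBlocks b k P (suc m)
  r : ℕ
  r = blockAt b k P m
  top : ℕ
  top = dropBlocks b k P (suc n + m)
  g : ℕ → ℕ
  g i = blockAt b k P (suc n + m ∸ suc i)
  s : ℕ
  s = sum (map g (upTo n))
  blocks-suc : sum (map g (upTo (suc n))) ≡ s + r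
  blocks-suc = trans (sum-upTo-suc g n)
    (cong (λ w → s + blockAt b k P w) (trans (cong (_∸ n) (+-comm n m)) (m+n∸n≡m m n)))

period≡S : ∀ b N L d x → 1 ≤ b → 1 ≤ d → d ∣ L → x ≤ N →
  Σ ℕ (λ C → period b N L x ≡ S b N L d x + (b ^ (L div' d) ∸ 1) * C)
period≡S b N L d x 1≤b 1≤d d∣L x≤N = C , (begin
    P                                                   ≡⟨ sym (n/1≡n P) ⟩
    dropBlocks b k P 0                                  ≡⟨ proj₂ decomposition ⟩
    dropBlocks b k P d + S b N L d x + (b ^ k ∸ 1) * C  ≡⟨ cong (λ w → w + S b N L d x + (b ^ k ∸ 1) * C) no-top-blocks ⟩
    S b N L d x + (b ^ k ∸ 1) * C                       ∎)
  where
  open ≡-Reasoning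
  P : ℕ
  P = period b N L x
  k : ℕ
  k = L div' d
  -- Blocks 0, …, d-1 of P are exactly the A_j, listed from j = 1.
  decomposition : Σ ℕ (λ C → dropBlocks b k P 0 ≡ dropBlocks b k P d + S b N L d x + (b ^ k ∸ 1) * C)
  decomposition = dropBlocks-sum b k P 1≤b d 0 d (+-identityʳ d)
  C : ℕ
  C = proj₁ decomposition
  -- P has at most L = d k digits, so nothing lies above block d - 1.
  no-top-blocks : dropBlocks b k P d ≡ 0
  no-top-blocks = trans (cong (λ w → P div' (b ^ w)) (trans (*-comm d k) (div'-exact L d 1≤d d∣L)))
                    (div'-small P (b ^ L) (period-< b N L x 1≤b x≤N))

midy⇒period1 : ∀ b N L d → 1 ≤ b → 2 ≤ N → InMidy b N L d →
  (b ^ (L div' d) ∸ 1) ∣ period b N L 1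
midy⇒period1 b N L d 1≤b 2≤N (2≤d , d∣L , midy)
  with period≡S b N L d 1 1≤b (≤-trans (s≤s z≤n) 2≤d) d∣L (≤-trans (n≤1+n 1) 2≤N)
... | C , eq = subst (_ ∣_) (sym eq) (∣m∣n⇒∣m+n (midy 1 ≤-refl 2≤N coprime-1) (m∣m*n C))
  where
  coprime-1 : Coprime 1 N
  coprime-1 (i∣1 , _) = ∣1⇒≡1 i∣1

period⇒midy-sum : ∀ b N L d x → 1 ≤ b → 1 ≤ d → d ∣ L → x ≤ N →
  (b ^ (L div' d) ∸ 1) ∣ period b N L x → (b ^ (L div' d) ∸ 1) ∣ S b N L d x
period⇒midy-sum b N L d x 1≤b 1≤d d∣L x≤N e∣P with period≡S b N L d x 1≤b 1≤d d∣L x≤N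
... | C , eq = ∣m+n∣m⇒∣n (subst (_ ∣_) (trans eq (+-comm (S b N L d x) _)) e∣P) (m∣m*n C)

-- A modulus of order L ≥ 2 is at least 2 (modulo 1 the order is 1).
order≥2⇒modulus≥2 : ∀ b N L → 1 ≤ N → IsOrder b N L → 2 ≤ L → 2 ≤ N
order≥2⇒modulus≥2 b (suc (suc N)) L _ _ _ = s≤s (s≤s z≤n)
order≥2⇒modulus≥2 b (suc zero) L _ (_ , _ , minimal) 2≤L =
  ≤-trans 2≤L (minimal 1 ≤-refl (divides (b ^ 1 ∸ 1) (sym (*-identityʳ _))))

order-lift : ∀ b N M L → IsOrder b N L → N ∣ M → M ∣ (b ^ L ∸ 1) → IsOrder b M L
order-lift b N M L (1≤L , _ , minimal) N∣M M∣ = 1≤L , M∣ , λ m 1≤m M∣m → minimal m 1≤m (∣-trans N∣M M∣m)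

rep : ℕ → ℕ → ℕ
rep b zero = 0
rep b (suc n) = suc (b * rep b n)

pow∸1≡rep : ∀ a n → suc a ^ n ∸ 1 ≡ a * rep (suc a) n
pow∸1≡rep a zero = sym (*-zeroʳ a)
pow∸1≡rep a (suc n) = begin
    suc a * suc a ^ n ∸ 1       ≡⟨ cong (λ w → suc a * w ∸ 1) (sym (m∸n+n≡m (pow-pos (suc a) n (s≤s z≤n)))) ⟩
    suc a * (suc a ^ n ∸ 1 + 1) ∸ 1 ≡⟨ cong (λ w → suc a * (w + 1) ∸ 1) (pow∸1≡rep a n) ⟩
    suc a * (a * r + 1) ∸ 1     ≡⟨ cong (_∸ 1) (solve 2 (λ a r → (con 1 :+ a) :* (a :* r :+ con 1) := con 1 :+ a :* (con 1 :+ (con 1 :+ a) :* r)) refl a r) ⟩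
    a * rep (suc a) (suc n)     ∎
  where
  open ≡-Reasoning
  r : ℕ
  r = rep (suc a) n

-- A positive repunit is ≡ 1 (mod b), hence coprime to b.
rep-coprime : ∀ b n → 1 ≤ n → Coprime (rep b n) b
rep-coprime b (suc n) _ {i} (i∣R , i∣b) =
  ∣1⇒≡1 (∣m+n∣m⇒∣n (subst (i ∣_) (+-comm 1 (b * rep b n)) i∣R) (∣-trans i∣b (m∣m*n (rep b n))))

rep≡1 : ∀ b n → 1 ≤ b → rep b n ≡ 1 → n ≡ 1
rep≡1 (suc b) (suc zero) _ _ = refl
rep≡1 (suc b) (suc (suc n)) _ ()

rep≥2 : ∀ b n → 1 ≤ b → 2 ≤ n → 2 ≤ rep b n
rep≥2 b (suc zero) _ (s≤s ())
rep≥2 b (suc (suc n)) 1≤b _ = s≤s (*-mono-≤ 1≤b (s≤s z≤n))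

rep-period : ∀ a L x → 1 ≤ L → period (suc a) (rep (suc a) L) L x ≡ x * a
rep-period a (suc L) x _ = begin
    (x * (suc a ^ suc L ∸ 1)) div' R  ≡⟨ cong (λ w → (x * w) div' R) (pow∸1≡rep a (suc L)) ⟩
    (x * (a * R)) div' R              ≡⟨ cong (_div' R) (sym (*-assoc x a R)) ⟩
    (x * a * R) div' R                ≡⟨ mul-div' (x * a) R (s≤s z≤n) ⟩
    x * a                             ∎
  where
  open ≡-Reasoning
  R : ℕ
  R = rep (suc a) (suc L)

pow-div'-self : ∀ b L → 1 ≤ L → b ^ (L div' L) ≡ b
pow-div'-self b (suc L) _ = trans (cong (b ^_) (n/n≡1 (suc L))) (*-identityʳ b)

-- L ∈ M_b(R_L): with k = 1 the Midy sum is the digit sum, and periods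
-- are multiples of b - 1.
L∈midy-rep : ∀ a L → 2 ≤ L → InMidy (suc a) (rep (suc a) L) L L
L∈midy-rep a L 2≤L = 2≤L , ∣-refl , λ x _ x<R _ →
  period⇒midy-sum b R L L x (s≤s z≤n) 1≤L ∣-refl (<⇒≤ x<R)
    (subst₂ _∣_ (sym e≡a) (sym (rep-period a L x 1≤L)) (n∣m*n x))
  where
  b : ℕ
  b = suc a
  R : ℕ
  R = rep b L
  1≤L : 1 ≤ L
  1≤L = ≤-trans (n≤1+n 1) 2≤L
  e≡a : b ^ (L div' L) ∸ 1 ≡ a
  e≡a = cong (_∸ 1) (pow-div'-self b L 1≤L)

-- Every d ∈ M_b(R_L) equals L: b^(L/d) - 1 ∣ b - 1 forces R_(L/d) = 1.
midy-rep⇒≡L : ∀ a L d → 1 ≤ a → 2 ≤ L → InMidy (suc a) (rep (suc a) L) L d → d ≡ L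
midy-rep⇒≡L a L d 1≤a 2≤L midy@(2≤d , d∣L , _) = begin
    d                  ≡⟨ sym (*-identityʳ d) ⟩
    d * 1              ≡⟨ cong (d *_) (sym k≡1) ⟩
    d * k              ≡⟨ *-comm d k ⟩
    k * d              ≡⟨ div'-exact L d (≤-trans (n≤1+n 1) 2≤d) d∣L ⟩
    L                  ∎
  where
  open ≡-Reasoning
  b : ℕ
  b = suc a
  k : ℕ
  k = L div' d
  e∣a : a * rep b k ∣ a * 1
  e∣a = subst₂ _∣_ (pow∸1≡rep a k) (trans (rep-period a L 1 (≤-trans (n≤1+n 1) 2≤L)) (*-comm 1 a))
          (midy⇒period1 b (rep b L) L d (s≤s z≤n) (rep≥2 b L (s≤s z≤n) 2≤L) midy)
  k≡1 : k ≡ 1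
  k≡1 = rep≡1 b k (s≤s z≤n) (∣1⇒≡1 (*-cancelˡ-∣ a {{>-nonZero 1≤a}} e∣a))

rep-multiple : ∀ a N L k u → 1 ≤ a → 1 ≤ N → N ∣ (suc a ^ L ∸ 1) →
  period (suc a) N L 1 ≡ u * (suc a ^ k ∸ 1) → u * rep (suc a) k * N ≡ rep (suc a) L
rep-multiple a N L k u 1≤a 1≤N N∣ period≡ = *-cancelˡ-≡ _ _ a {{>-nonZero 1≤a}} (begin
    a * (u * rep b k * N)    ≡⟨ solve 4 (λ u a r n → a :* (u :* r :* n) := u :* (a :* r) :* n) refl u a (rep b k) N ⟩
    u * (a * rep b k) * N    ≡⟨ cong (λ w → u * w * N) (sym (pow∸1≡rep a k)) ⟩
    u * (b ^ k ∸ 1) * N      ≡⟨ cong (_* N) (sym period≡) ⟩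
    period b N L 1 * N       ≡⟨ cong (λ w → w div' N * N) (*-identityˡ (b ^ L ∸ 1)) ⟩
    (b ^ L ∸ 1) div' N * N   ≡⟨ div'-exact (b ^ L ∸ 1) N 1≤N N∣ ⟩
    b ^ L ∸ 1                ≡⟨ pow∸1≡rep a L ⟩
    a * rep b L              ∎)
  where
  open ≡-Reasoning
  b : ℕ
  b = suc a

lemma2p11 : (b N L q : ℕ) → 2 ≤ b → 1 ≤ N → Coprime N b → IsOrder b N L →
    Σ ℕ (λ d → InMidy b N L d) → Prime q → q ∣ L →
    Σ ℕ (λ z → (1 ≤ z) × Coprime z b × IsOrder b (z * N) L ×
    Σ ℕ (λ d → InMidy b (z * N) L d) ×
    (∀ d → InMidy b (z * N) L d → ∀ e → Val q L e → Val q d e))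
lemma2p11 (suc a) N L q (s≤s 1≤a) 1≤N _ order@(1≤L , N∣ , _) (d₀ , midy₀@(2≤d₀ , d₀∣L , _)) _ _ =
  z , 1≤z , coprime-z , order-lift b N (z * N) L order (n∣m*n z) zN∣ ,
  (L , subst (λ M → InMidy b M L L) (sym zN≡R) (L∈midy-rep a L 2≤L)) ,
  λ d midy e ν → subst (λ w → Val q w e) (sym (midy-rep⇒≡L a L d 1≤a 2≤L (subst (λ M → InMidy b M L d) zN≡R midy))) ν
  where
  b : ℕ
  b = suc a
  2≤L : 2 ≤ L
  2≤L = ≤-trans 2≤d₀ (∣⇒≤ {{>-nonZero 1≤L}} d₀∣L)
  u∣ : (b ^ (L div' d₀) ∸ 1) ∣ period b N L 1
  u∣ = midy⇒period1 b N L d₀ (s≤s z≤n) (order≥2⇒modulus≥2 b N L 1≤N order 2≤L) midy₀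
  u : ℕ
  u = _∣_.quotient u∣
  z : ℕ
  z = u * rep b (L div' d₀)
  zN≡R : z * N ≡ rep b L
  zN≡R = rep-multiple a N L (L div' d₀) u 1≤a 1≤N N∣ (_∣_.equality u∣)
  zN∣ : z * N ∣ (b ^ L ∸ 1)
  zN∣ = divides a (trans (pow∸1≡rep a L) (cong (a *_) (sym zN≡R)))
  1≤z : 1 ≤ z
  1≤z = >-nonZero⁻¹ z {{m*n≢0⇒m≢0 z {{>-nonZero (subst (1 ≤_) (sym zN≡R) (≤-trans (n≤1+n 1) (rep≥2 b L (s≤s z≤n) 2≤L)))}}}}
  coprime-z : Coprime z b
  coprime-z (i∣z , i∣b) = rep-coprime b L 1≤L (subst (_ ∣_) zN≡R (∣-trans i∣z (m∣m*n N)) , i∣b)
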